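{- Let $G$ be a finite simple connected graph of order $n$ and diameter $d$, and let $k\ge 0$ be an integer. Then $\mu_k(G)\le n-d+k+1$.
   Context: For $X\subseteq V(G)$ and an integer $k\ge 0$, two vertices $u,v\in V(G)$ are called $(X,k)$-visible if there exists a shortest $(u,v)$-path in $G$ having at most $k$ internal vertices that lie in $X$. A set $X\subseteq V(G)$ is a mutual $k$-visible set if every pair of distinct vertices of $X$ is $(X,k)$-visible. The mutual $k$-visibility number $\mu_k(G)$ is the maximum cardinality of a mutual $k$-visible set in $G$. -}

module Defs where

open import Data.Nat using (ℕ; zero; suc; _+_; _≤_; _<_)
open import Data.Fin using (Fin)
open import Data.Fin.Subset using (Subset; _∈_; ∣_∣)
open import Data.Fin.Subset.Properties using (_∈?_)
open import Data.List using (List; []; _∷_; length; filter)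
open import Data.Product using (Σ; ∃; _×_; _,_)
open import Relation.Binary.PropositionalEquality using (_≡_)
open import Relation.Nullary using (¬_)
open import Relation.Nullary.Decidable using (Dec)
open import Level using (0ℓ)

record Graph (n : ℕ) : Set₁ where
  field
    Adj      : Fin n → Fin n → Set
    adj?     : ∀ u v → Dec (Adj u v)
    irrefl   : ∀ u → ¬ Adj u u
    sym      : ∀ {u v} → Adj u v → Adj v u
open Graph public

module _ {n : ℕ} (G : Graph n) where

  data Walk : Fin n → Fin n → Set where
    [] : ∀ {u} → Walk u u
    _∷_ : ∀ {u w v} → Adj G u w → Walk w v → Walk u v

  len : ∀ {u v} → Walk u v → ℕ
  len [] = 0
  len (_ ∷ p) = suc (len p)

  internal : ∀ {u v} → Walk u v → List (Fin n)
  internal [] = []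
  internal (_ ∷ []) = []
  internal (_∷_ {w = w} _ (e ∷ p)) = w ∷ internal (e ∷ p)

  -- a shortest (u,v)-walk: no (u,v)-walk has fewer edges (hence it is a path)
  IsShortest : ∀ {u v} → Walk u v → Set
  IsShortest {u} {v} p = ∀ (q : Walk u v) → len p ≤ len q

  Dist : Fin n → Fin n → ℕ → Set
  Dist u v ℓ = Σ (Walk u v) λ p → IsShortest p × len p ≡ ℓ

  Connected : Set
  Connected = ∀ u v → Walk u v

  Diameter : ℕ → Set
  Diameter d = (Σ (Fin n) λ u → Σ (Fin n) λ v → Dist u v d)
             × (∀ u v ℓ → Dist u v ℓ → ℓ ≤ d)

  internalIn : Subset n → ∀ {u v} → Walk u v → ℕ
  internalIn X p = length (filter (λ x → x ∈? X) (internal p))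

  Visible : Subset n → ℕ → Fin n → Fin n → Set
  Visible X k u v = Σ (Walk u v) λ p → IsShortest p × internalIn X p ≤ k

  MutualVisible : ℕ → Subset n → Set
  MutualVisible k X = ∀ u v → u ∈ X → v ∈ X → ¬ u ≡ v → Visible X k u v

-- Let u, v be at distance d and sort the vertices into the levels 0, …, d of their distance
-- to v, truncated at d; the level changes by at most one along an edge and every level
-- occurs on a shortest (u,v)-path. Call a level full if it lies inside X. Each non-full
-- level contains a vertex outside X. If i < j are full levels, pick vertices of X in them:
-- a shortest path between them visits every level strictly between i and j at an internal
-- vertex, so mutual k-visibility allows at most k full levels there. Hence at most k + 2 of
-- the d + 1 levels are full and |X| ≤ n − (d + 1 − (k + 2)).
module Submission where

open import Defs
open import Data.Nat using (ℕ; zero; suc; _+_; _∸_; _≤_; _<_; z≤n; s≤s; s≤s⁻¹; _<?_; _≤?_; _≟_)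
open import Data.Nat.Properties
open import Data.Fin as Fin using (Fin)
open import Data.Fin.Properties using (any?; all?; ¬∀⟶∃¬)
open import Data.Fin.Subset using (Subset; ∣_∣; _∈_; _∉_; _⊂_; _∪_; ⁅_⁆)
open import Data.Fin.Subset.Properties
  using (_∈?_; p⊂q⇒∣p∣<∣q∣; p⊆p∪q; x∈p∪q⁺; x∈p∪q⁻; x∈⁅x⁆; x∈⁅y⁆⇒x≡y; ∣p∣≤n)
open import Data.List using (length)
open import Data.List.Properties using (filter-accept)
open import Data.Product using (Σ-syntax; ∃; _×_; _,_)
open import Data.Sum as Sum using (_⊎_; inj₁; inj₂; [_,_]′)
open import Function using (_∘_)
open import Level using (Level)
open import Relation.Nullary using (¬_; Dec; yes; no; contradiction)
open import Relation.Nullary.Decidable using (_⊎-dec_; _×-dec_; _→-dec_)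
open import Relation.Unary using (Decidable)
open import Relation.Binary.PropositionalEquality
  using (_≡_; _≢_; refl; trans; cong; subst; subst₂) renaming (sym to ≡-sym)

private
  variable
    p : Level
    P : ℕ → Set p

least : Decidable P → ℕ → ℕ
least P? zero = 0
least P? (suc b) with P? 0
... | yes _ = 0
... | no _ = suc (least (P? ∘ suc) b)

least≤ : (P? : Decidable P) (b : ℕ) → least P? b ≤ b
least≤ P? zero = z≤n
least≤ P? (suc b) with P? 0
... | yes _ = z≤n
... | no _ = s≤s (least≤ (P? ∘ suc) b)

least-minimal : (P? : Decidable P) (b : ℕ) {t : ℕ} → P t → least P? b ≤ t
least-minimal P? zero _ = z≤n
least-minimal P? (suc b) Pt with P? 0
least-minimal P? (suc b) {_}     Pt | yes _ = z≤n
least-minimal P? (suc b) {zero}  Pt | no ¬P0 = contradiction Pt ¬P0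
least-minimal P? (suc b) {suc t} Pt | no _ = s≤s (least-minimal (P? ∘ suc) b Pt)

least-satisfies : (P? : Decidable P) (b : ℕ) → least P? b < b → P (least P? b)
least-satisfies P? zero ()
least-satisfies P? (suc b) lt with P? 0
... | yes P0 = P0
... | no _ = least-satisfies (P? ∘ suc) b (s≤s⁻¹ lt)

count : Decidable P → ℕ → ℕ → ℕ
count P? i zero = 0
count P? i (suc l) with P? i
... | yes _ = suc (count P? (suc i) l)
... | no _ = count P? (suc i) l

count-suc-≤ : (P? : Decidable P) (i l : ℕ) → count P? i (suc l) ≤ suc (count P? i l)
count-suc-≤ P? i zero with P? i
... | yes _ = ≤-refl
... | no _ = z≤n
count-suc-≤ P? i (suc l) with P? i
... | yes _ = s≤s (count-suc-≤ P? (suc i) l)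
... | no _ = count-suc-≤ P? (suc i) l

count-suc-reject : (P? : Decidable P) (i l : ℕ) → ¬ P (i + l) → count P? i (suc l) ≡ count P? i l
count-suc-reject {P = P} P? i zero ¬P with P? i
... | yes Pi = contradiction (subst P (≡-sym (+-identityʳ i)) Pi) ¬P
... | no _ = refl
count-suc-reject {P = P} P? i (suc l) ¬P with P? i
... | yes _ = cong suc (count-suc-reject P? (suc i) l (subst (¬_ ∘ P) (+-suc i l) ¬P))
... | no _ = count-suc-reject P? (suc i) l (subst (¬_ ∘ P) (+-suc i l) ¬P)

module Distance {n : ℕ} (G : Graph n) (v : Fin n) where

  ReachesWithin : ℕ → Fin n → Set
  ReachesWithin zero w = w ≡ v
  ReachesWithin (suc t) w = w ≡ v ⊎ ∃ λ w′ → Adj G w w′ × ReachesWithin t w′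

  reachesWithin? : ∀ t w → Dec (ReachesWithin t w)
  reachesWithin? zero w = w Fin.≟ v
  reachesWithin? (suc t) w = w Fin.≟ v ⊎-dec any? λ w′ → adj? G w w′ ×-dec reachesWithin? t w′

  reaches⇒walk : ∀ t {w} → ReachesWithin t w → Σ[ q ∈ Walk G w v ] len G q ≤ t
  reaches⇒walk zero refl = [] , z≤n
  reaches⇒walk (suc t) (inj₁ refl) = [] , z≤n
  reaches⇒walk (suc t) (inj₂ (_ , e , r)) with reaches⇒walk t r
  ... | q , q≤t = e ∷ q , s≤s q≤t

  walk⇒reaches : ∀ {w} (q : Walk G w v) → ReachesWithin (len G q) w
  walk⇒reaches [] = refl
  walk⇒reaches (e ∷ q) = inj₂ (_ , e , walk⇒reaches q)

  -- level d w = min d (distance from w to v)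
  level : ℕ → Fin n → ℕ
  level d w = least (λ t → reachesWithin? t w) d

  level≤ : ∀ d w → level d w ≤ d
  level≤ d w = least≤ (λ t → reachesWithin? t w) d

  level-lipschitz : ∀ d {w w′} → Adj G w w′ → level d w ≤ suc (level d w′)
  level-lipschitz d {w} {w′} e with level d w′ <? d
  ... | yes lt = least-minimal _ d (inj₂ (w′ , e , least-satisfies _ d lt))
  ... | no ¬lt = ≤-trans (level≤ d w) (≤-trans (≮⇒≥ ¬lt) (n≤1+n _))

  level-shortest : ∀ {d w} (q : Walk G w v) → IsShortest G q → len G q ≤ d → level d w ≡ len G q
  level-shortest {d} {w} q shortest q≤d =
    ≤-antisym (least-minimal _ d (walk⇒reaches q)) (≮⇒≥ shorter-absurd)
    where
    shorter-absurd : ¬ level d w < len G q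
    shorter-absurd lt with reaches⇒walk _ (least-satisfies _ d (<-≤-trans lt q≤d))
    ... | s , s≤ = <⇒≱ (≤-<-trans s≤ lt) (shortest s)

  shortest-tail : ∀ {u w} (e : Adj G u w) (q : Walk G w v) → IsShortest G (e ∷ q) → IsShortest G q
  shortest-tail e q shortest s = s≤s⁻¹ (shortest (e ∷ s))

  levels-along-shortest : ∀ {d w} (q : Walk G w v) → IsShortest G q → len G q ≤ d →
                          ∀ m → m ≤ len G q → ∃ λ x → level d x ≡ m
  levels-along-shortest {w = w} q shortest q≤d m m≤q with m ≟ len G q
  ... | yes refl = w , level-shortest q shortest q≤d
  levels-along-shortest [] _ _ m m≤q | no m≢q = contradiction (n≤0⇒n≡0 m≤q) m≢q
  levels-along-shortest (e ∷ q) shortest e∷q≤d m m≤q | no m≢q =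
    levels-along-shortest q (shortest-tail e q shortest) (≤-trans (n≤1+n _) e∷q≤d) m
      (m<1+n⇒m≤n (≤∧≢⇒< m≤q m≢q))

  level-onto : ∀ {u d} → Dist G u v d → ∀ m → m ≤ d → ∃ λ x → level d x ≡ m
  level-onto (p , shortest , refl) = levels-along-shortest p shortest ≤-refl

module Levels {n : ℕ} (f : Fin n → ℕ) (X : Subset n) where

  Full : ℕ → Set
  Full m = ∀ w → f w ≡ m → w ∈ X

  full? : Decidable Full
  full? m = all? λ w → (f w ≟ m) →-dec (w ∈? X)

  nonfull-witness : ∀ {m} → ¬ Full m → ∃ λ w → f w ≡ m × w ∉ X
  nonfull-witness {m} ¬full with ¬∀⟶∃¬ n _ (λ w → (f w ≟ m) →-dec (w ∈? X)) ¬full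
  ... | w , ¬impl with f w ≟ m
  ...   | yes fw≡m = w , fw≡m , λ w∈X → ¬impl λ _ → w∈X
  ...   | no fw≢m = contradiction (λ fw≡m → contradiction fw≡m fw≢m) ¬impl

  extend-by-nonfull-levels : ∀ i l → Σ[ S ∈ Subset n ] (∀ {w} → w ∈ S → w ∈ X ⊎ i ≤ f w)
                                                      × ∣ X ∣ + l ≤ ∣ S ∣ + count full? i l
  extend-by-nonfull-levels i zero = X , inj₁ , ≤-refl
  extend-by-nonfull-levels i (suc l) with extend-by-nonfull-levels (suc i) l | full? i
  ... | S , S⊆ , bound | yes _ =
    S , Sum.map₂ <⇒≤ ∘ S⊆ , subst₂ _≤_ (≡-sym (+-suc _ l)) (≡-sym (+-suc _ _)) (s≤s bound)
  ... | S , S⊆ , bound | no ¬full with nonfull-witness ¬full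
  ...   | w , fw≡i , w∉X = S ∪ ⁅ w ⁆ , S∪w⊆ , bound′
    where
    w∉S : w ∉ S
    w∉S w∈S = [ w∉X , (λ i<fw → <-irrefl (≡-sym fw≡i) i<fw) ]′ (S⊆ w∈S)

    S∪w⊆ : ∀ {x} → x ∈ S ∪ ⁅ w ⁆ → x ∈ X ⊎ i ≤ f x
    S∪w⊆ x∈S∪w with x∈p∪q⁻ S ⁅ w ⁆ x∈S∪w
    ... | inj₁ x∈S = Sum.map₂ <⇒≤ (S⊆ x∈S)
    ... | inj₂ x∈w rewrite x∈⁅y⁆⇒x≡y w x∈w = inj₂ (≤-reflexive (≡-sym fw≡i))

    bound′ : ∣ X ∣ + suc l ≤ ∣ S ∪ ⁅ w ⁆ ∣ + count full? (suc i) l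
    bound′ = begin
      ∣ X ∣ + suc l                         ≡⟨ +-suc ∣ X ∣ l ⟩
      suc (∣ X ∣ + l)                       ≤⟨ s≤s bound ⟩
      suc ∣ S ∣ + count full? (suc i) l     ≤⟨ +-monoˡ-≤ _ (p⊂q⇒∣p∣<∣q∣ S⊂S∪w) ⟩
      ∣ S ∪ ⁅ w ⁆ ∣ + count full? (suc i) l ∎
      where
      open ≤-Reasoning
      S⊂S∪w : S ⊂ S ∪ ⁅ w ⁆
      S⊂S∪w = p⊆p∪q {p = S} ⁅ w ⁆ , w , x∈p∪q⁺ (inj₂ (x∈⁅x⁆ w)) , w∉S

  ∣X∣+l≤n+fulls : ∀ l → ∣ X ∣ + l ≤ n + count full? 0 l
  ∣X∣+l≤n+fulls l with extend-by-nonfull-levels 0 l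
  ... | S , _ , bound = ≤-trans bound (+-monoˡ-≤ _ (∣p∣≤n S))

  module Crossing (G : Graph n) (f-lipschitz : ∀ {w w′} → Adj G w w′ → f w ≤ suc (f w′)) where

    internalIn-∷-≤ : ∀ {a w b} (e : Adj G a w) (q : Walk G w b) →
                     internalIn G X q ≤ internalIn G X (e ∷ q)
    internalIn-∷-≤ e [] = z≤n
    internalIn-∷-≤ {w = w} e (_ ∷ _) with w ∈? X
    ... | yes _ = n≤1+n _
    ... | no _ = ≤-refl

    internalIn-∷-∈ : ∀ {a w c b} (e : Adj G a w) (e′ : Adj G w c) (q : Walk G c b) → w ∈ X →
                     internalIn G X (e ∷ (e′ ∷ q)) ≡ suc (internalIn G X (e′ ∷ q))
    internalIn-∷-∈ e e′ q w∈X = cong length (filter-accept (_∈? X) w∈X)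

    entering-level : ∀ {a w c b} (e : Adj G a w) (e′ : Adj G w c) (q : Walk G c b) {m} → f w ≡ m →
                     ∀ l → count full? (suc m) l ≤ internalIn G X (e′ ∷ q) →
                     count full? m (suc l) ≤ internalIn G X (e ∷ (e′ ∷ q))
    entering-level e e′ q {m} fw≡m l bound with full? m
    ... | yes full = subst (_ ≤_) (≡-sym (internalIn-∷-∈ e e′ q (full _ fw≡m))) (s≤s bound)
    ... | no _ = ≤-trans bound (internalIn-∷-≤ e (e′ ∷ q))

    -- Since f changes by at most one per edge, a walk leaving level ≤ i for a level above i + l
    -- has an internal vertex on each of the levels i + 1, …, i + l.
    CrossesFull : ∀ {a b} → Walk G a b → Set
    CrossesFull {a} {b} p = ∀ {i} l → f a ≤ i → i + l < f b → count full? (suc i) l ≤ internalIn G X p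

    crossesFull-∷ : ∀ {a w c b} (e : Adj G a w) (e′ : Adj G w c) (q : Walk G c b) →
                    CrossesFull (e′ ∷ q) → CrossesFull (e ∷ (e′ ∷ q))
    crossesFull-∷ e e′ q crosses zero _ _ = z≤n
    crossesFull-∷ {w = w} {b = b} e e′ q crosses {i} (suc l) fa≤i lt with f w ≤? i
    ... | yes fw≤i = ≤-trans (crosses (suc l) fw≤i lt) (internalIn-∷-≤ e (e′ ∷ q))
    ... | no fw≰i = entering-level e e′ q fw≡ l
                      (crosses l (≤-reflexive fw≡) (subst (_< f b) (+-suc i l) lt))
      where
      fw≡ : f w ≡ suc i
      fw≡ = ≤-antisym (≤-trans (f-lipschitz (sym G e)) (s≤s fa≤i)) (≰⇒> fw≰i)

    crossesFull : ∀ {a b} (p : Walk G a b) → CrossesFull p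
    crossesFull p zero _ _ = z≤n
    crossesFull [] {i} (suc l) fa≤i lt = contradiction (<-≤-trans lt fa≤i) (m+n≮m i (suc l))
    crossesFull (e ∷ []) {i} (suc l) fa≤i lt =
      contradiction (s≤s⁻¹ (≤-trans lt (≤-trans (f-lipschitz (sym G e)) (s≤s fa≤i)))) (m+1+n≰m i)
    crossesFull (e ∷ (e′ ∷ q)) = crossesFull-∷ e e′ q (crossesFull (e′ ∷ q))

    module _ {d k : ℕ} (onto : ∀ m → m ≤ d → ∃ λ w → f w ≡ m) (visible : MutualVisible G k X) where

      fulls-between : ∀ {i} l → suc i + l ≤ d → Full i → Full (suc i + l) → count full? (suc i) l ≤ k
      fulls-between {i} l j≤d full-i full-j
        with onto i (≤-trans (≤-trans (n≤1+n i) (m≤m+n (suc i) l)) j≤d) | onto (suc i + l) j≤d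
      ... | x , fx≡i | y , fy≡j with visible x y (full-i x fx≡i) (full-j y fy≡j) x≢y
        where
        x≢y : x ≢ y
        x≢y x≡y = m≢1+m+n i (trans (≡-sym fx≡i) (trans (cong f x≡y) fy≡j))
      ...   | p , _ , p≤k = ≤-trans (crossesFull p l (≤-reflexive fx≡i) (≤-reflexive (≡-sym fy≡j))) p≤k

      fulls-above : ∀ {i} l → i + l ≤ d → Full i → count full? (suc i) l ≤ suc k
      fulls-above zero _ _ = z≤n
      fulls-above {i} (suc l) i+l≤d full-i with full? (suc i + l)
      ... | yes full-j = ≤-trans (count-suc-≤ full? (suc i) l)
                           (s≤s (fulls-between l (subst (_≤ d) (+-suc i l) i+l≤d) full-i full-j))
      ... | no ¬full-j = subst (_≤ suc k) (≡-sym (count-suc-reject full? (suc i) l ¬full-j))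
                           (fulls-above l (≤-trans (+-monoʳ-≤ i (n≤1+n l)) i+l≤d) full-i)

      fulls-total : ∀ i l → i + l ≤ suc d → count full? i l ≤ suc (suc k)
      fulls-total i zero _ = z≤n
      fulls-total i (suc l) i+l≤ with full? i
      ... | yes full-i = s≤s (fulls-above l (s≤s⁻¹ (subst (_≤ suc d) (+-suc i l) i+l≤)) full-i)
      ... | no _ = fulls-total (suc i) l (subst (_≤ suc d) (+-suc i l) i+l≤)

      mutualVisible-bound : ∣ X ∣ + d ≤ n + suc k
      mutualVisible-bound = s≤s⁻¹ (begin
        suc (∣ X ∣ + d)           ≡⟨ +-suc ∣ X ∣ d ⟨
        ∣ X ∣ + suc d             ≤⟨ ∣X∣+l≤n+fulls (suc d) ⟩
        n + count full? 0 (suc d) ≤⟨ +-monoʳ-≤ n (fulls-total 0 (suc d) ≤-refl) ⟩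
        n + suc (suc k)           ≡⟨ +-suc n (suc k) ⟩
        suc (n + suc k)           ∎)
        where open ≤-Reasoning

m+n≤o+p⇒m≤o∸n+p : ∀ m n o p → m + n ≤ o + p → m ≤ o ∸ n + p
m+n≤o+p⇒m≤o∸n+p m n o p le = +-cancelʳ-≤ n m (o ∸ n + p) (begin
  m + n               ≤⟨ le ⟩
  o + p               ≤⟨ +-monoˡ-≤ p (m≤n+m∸n o n) ⟩
  n + (o ∸ n) + p     ≡⟨ +-assoc n (o ∸ n) p ⟩
  n + (o ∸ n + p)     ≡⟨ +-comm n (o ∸ n + p) ⟩
  o ∸ n + p + n       ∎)
  where open ≤-Reasoning

theorem3p7 : (n : ℕ) (G : Graph n) → Connected G → (d : ℕ) → Diameter G d → (k : ℕ) → (X : Subset n) → MutualVisible G k X → ∣ X ∣ ≤ n ∸ d + k + 1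
theorem3p7 n G _ d ((u , v , diametral) , _) k X visible =
  subst (∣ X ∣ ≤_) (≡-sym (+-assoc (n ∸ d) k 1))
    (m+n≤o+p⇒m≤o∸n+p ∣ X ∣ d n (k + 1) (subst (λ c → ∣ X ∣ + d ≤ n + c) (+-comm 1 k) bound))
  where
  open Distance G v
  bound : ∣ X ∣ + d ≤ n + suc k
  bound = Levels.Crossing.mutualVisible-bound (level d) X G (level-lipschitz d) (level-onto diametral) visible
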